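{- Let $\Lambda$ be a labeled polytree sequent, $w$ a label of $\Lambda$, and $\mathsf P$ a finite set of simplified primitive tense axioms. For every structure $X$, the following rules, each usable in both directions, are derivable in $\mathsf{DK_tP}$: $\mathfrak D^w_1(\Lambda)\vdash X$ to ${\ast}\mathfrak D^w_2(\Lambda)\vdash X$; ${\ast}\mathfrak D^w_1(\Lambda)\vdash X$ to $\mathfrak D^w_2(\Lambda)\vdash X$; $X\vdash\mathfrak D^w_2(\Lambda)$ to $X\vdash{\ast}\mathfrak D^w_1(\Lambda)$; $X\vdash{\ast}\mathfrak D^w_2(\Lambda)$ to $X\vdash\mathfrak D^w_1(\Lambda)$.
   Context: Formulae: $A ::= p \mid \top \mid \bot \mid \neg A \mid (A\lor A)\mid (A\land A)\mid (A\to A)\mid \mathsf{G}A\mid \mathsf{F}A\mid \mathsf{H}A\mid \mathsf{P}A$. A simplified primitive tense axiom is $A\to(B_1\lor\dots\lor B_m)$ with $A,B_j$ built from atoms and $\top$ by $\land,\mathsf F,\mathsf P$, each atom at most once in $A$. Structures $X ::= A \mid I \mid {\ast}X \mid {\bullet}X \mid (X\circ X)$; display sequent $X\vdash Y$. $\mathsf{DK_tP}$ consists of: initial $p\vdash p$, $I\vdash\top$, $\bot\vdash I$; logical rules (premise(s)/conclusion): $I\vdash Y/\top\vdash Y$; $X\vdash I/X\vdash\bot$; ${\ast}A\vdash Y/\neg A\vdash Y$; $X\vdash{\ast}A/X\vdash\neg A$; $X\circ A\vdash B/X\vdash A\to B$; $X\vdash A,\ B\vdash Y/A\to B\vdash{\ast}X\circ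 Y$; $X\vdash A\circ B/X\vdash A\lor B$; $A\vdash Y,\ B\vdash Y/A\lor B\vdash Y$; $A\circ B\vdash Y/A\land B\vdash Y$; $X\vdash A,\ X\vdash B/X\vdash A\land B$; $A\vdash Y/\mathsf GA\vdash{\bullet}Y$; ${\bullet}X\vdash A/X\vdash\mathsf GA$; $A\vdash{\ast}{\bullet}{\ast}Y/\mathsf FA\vdash Y$; $X\vdash A/{\ast}{\bullet}{\ast}X\vdash\mathsf FA$; ${\ast}{\bullet}{\ast}X\vdash A/X\vdash\mathsf HA$; $A\vdash Y/\mathsf HA\vdash{\ast}{\bullet}{\ast}Y$; $A\vdash{\bullet}Y/\mathsf PA\vdash Y$; $X\vdash A/{\bullet}X\vdash\mathsf PA$; bidirectional display rules $X\circ Y\vdash Z\Leftrightarrow X\vdash Z\circ{\ast}Y$; $X\circ Y\vdash Z\Leftrightarrow Y\vdash{\ast}X\circ Z$; $X\vdash Y\circ Z\Leftrightarrow X\circ{\ast}Z\vdash Y$; $X\vdash Y\circ Z\Leftrightarrow{\ast}Y\circ X\vdash Z$; ${\ast}X\vdash Y\Leftrightarrow{\ast}Y\vdash X$; $X\vdash{\ast}Y\Leftrightarrow Y\vdash{\ast}X$; ${\ast}{\ast}X\vdash Y\Leftrightarrow X\vdash Y$; $X\vdash{\ast}{\ast}Y\Leftrightarrow X\vdash Y$; $X\vdash{\bullet}Y\Leftrightarrow{\bullet}X\vdash Y$; structural rules $X\vdash Y\Leftrightarrow I\circ X\vdash Y$; $X\vdash Y\Leftrightarrow X\vdash I\circ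 Y$; $I\vdash Y\Leftrightarrow{\ast}I\vdash Y$; $X\vdash I\Leftrightarrow X\vdash{\ast}I$; $X\circ(Y\circ Z)\vdash W\Leftrightarrow(X\circ Y)\circ Z\vdash W$; $X\vdash Y\circ(Z\circ W)\Leftrightarrow X\vdash(Y\circ Z)\circ W$; $X\vdash Y/Z\circ X\vdash Y$; $X\vdash Y/X\vdash Y\circ Z$; $X\circ Y\vdash Z/Y\circ X\vdash Z$; $X\vdash Y\circ Z/X\vdash Z\circ Y$; $X\circ X\vdash Y/X\vdash Y$; $X\vdash Y\circ Y/X\vdash Y$; $I\vdash Y/{\bullet}I\vdash Y$; $X\vdash I/X\vdash{\bullet}I$; $X\vdash A,\ A\vdash Y/X\vdash Y$; and for each axiom of $\mathsf P$ the rule with premises $\psi(B_j)\vdash X$ and conclusion $\psi(A)\vdash X$ ($\psi(\top)=I$, $\psi(p)=X_p$, $\psi(A\land B)=\psi(A)\circ\psi(B)$, $\psi(\mathsf FA)={\ast}{\bullet}{\ast}\psi(A)$, $\psi(\mathsf PA)={\bullet}\psi(A)$). A rule is derivable if its conclusion can be obtained from its premise by a finite tree of rule instances whose leaves are the premise or initial sequents. Labeled sequents $\mathcal R,\Gamma\Rightarrow\Delta$ ($\mathcal R$ finite set of relational atoms $Rwu$, $\Gamma,\Delta$ finite multisets of labeled formulae $w:A$). Labeled polytree sequent: (1) if no relational atoms, all formulae share one label; (2) otherwise every formula label occurs in a relational atom; (3) graph (nodes labels, edges $(w,u)$ for $Rwu$) connected, free of directed and undirected cycles. For $Rwu$ or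 $Ruw$ in a labeled polytree sequent $\Lambda'$, $\Lambda'|^w_u$ consists of the relational atoms (other than the one between $w,u$) and labeled formulae of $\Lambda'$ lying in the component of $u$ after removing the edge between $w$ and $u$. $\Gamma\restriction w$ is $A_1\circ\dots\circ A_n$ for the formulae $w:A_i$ in $\Gamma$, and $I$ if none. For $\Lambda'=\mathcal R',\Gamma'\Rightarrow\Delta'$: if $\mathcal R'=\emptyset$, $\mathfrak D^w_1(\Lambda')=(\Gamma'\restriction w)\circ{\ast}(\Delta'\restriction w)$, $\mathfrak D^w_2(\Lambda')={\ast}(\Gamma'\restriction w)\circ(\Delta'\restriction w)$; otherwise, with $Rwu_1,\dots,Rwu_n$ all atoms $Rwy$ and $Rv_1w,\dots,Rv_kw$ all atoms $Ryw$, $\mathfrak D^w_1(\Lambda')=(\Gamma'\restriction w)\circ{\ast}(\Delta'\restriction w)\circ{\ast}{\bullet}{\ast}\mathfrak D^{u_1}_1(\Lambda'|^w_{u_1})\circ\dots\circ{\ast}{\bullet}{\ast}\mathfrak D^{u_n}_1(\Lambda'|^w_{u_n})\circ{\bullet}\mathfrak D^{v_1}_1(\Lambda'|^w_{v_1})\circ\dots\circ{\bullet}\mathfrak D^{v_k}_1(\Lambda'|^w_{v_k})$, $\mathfrak D^w_2(\Lambda')={\ast}(\Gamma'\restriction w)\circ(\Delta'\restriction w)\circ{\bullet}\mathfrak D^{u_1}_2(\Lambda'|^w_{u_1})\circ\dots\circ{\bullet}\mathfrak D^{u_n}_2(\Lambda'|^w_{u_n})\circ{\ast}{\bullet}{\ast}\mathfrak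 D^{v_1}_2(\Lambda'|^w_{v_1})\circ\dots\circ{\ast}{\bullet}{\ast}\mathfrak D^{v_k}_2(\Lambda'|^w_{v_k})$. -}

module Defs where

open import Data.Nat using (ℕ; zero; suc; _≡ᵇ_)
open import Data.Bool using (Bool; true; false; not; if_then_else_) renaming (_∨_ to _or_; _∧_ to _and_)
open import Data.List using (List; []; _∷_; _++_; map; length; concatMap; lookup)
open import Data.List.NonEmpty using (List⁺; toList)
open import Data.List.Membership.Propositional using (_∈_)
open import Data.List.Relation.Unary.Any using (Any)
open import Data.List.Relation.Unary.All using (All)
open import Data.List.Relation.Unary.Unique.Propositional using (Unique)
open import Data.Fin using (Fin)
open import Data.Product using (Σ; ∃; _×_; _,_)
open import Data.Sum using (_⊎_)
open import Relation.Binary.PropositionalEquality using (_≡_; _≢_)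
open import Relation.Nullary using (¬_)

Atom : Set
Atom = ℕ

infixr 6 _∧ᶠ_
infixr 5 _∨ᶠ_
infixr 4 _→ᶠ_

data Fml : Set where
  var  : Atom → Fml
  ⊤ᶠ   : Fml
  ⊥ᶠ   : Fml
  ¬ᶠ_  : Fml → Fml
  _∨ᶠ_ : Fml → Fml → Fml
  _∧ᶠ_ : Fml → Fml → Fml
  _→ᶠ_ : Fml → Fml → Fml
  G    : Fml → Fml
  F    : Fml → Fml
  H    : Fml → Fml
  P    : Fml → Fml

-- Simplified primitive tense axioms  A → (B₁ ∨ … ∨ Bₘ)
-- A, Bⱼ built from atoms and ⊤ by ∧, F, P.

data PF : Set where
  atom : Atom → PF
  top  : PF
  _&_  : PF → PF → PF
  Fp   : PF → PF
  Pp   : PF → PF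

atomsPF : PF → List Atom
atomsPF (atom p) = p ∷ []
atomsPF top      = []
atomsPF (A & B)  = atomsPF A ++ atomsPF B
atomsPF (Fp A)   = atomsPF A
atomsPF (Pp A)   = atomsPF A

record Axiom : Set where
  constructor axiom
  field
    ante : PF
    disj : List⁺ PF
    once : Unique (atomsPF ante)

infixr 8 ∗_ •_
infixr 7 _∘_
infix 4 _⊢_

data Str : Set where
  ⌜_⌝ : Fml → Str
  I   : Str
  ∗_  : Str → Str
  •_  : Str → Str
  _∘_ : Str → Str → Str

data Seq : Set where
  _⊢_ : Str → Str → Seq

-- ψ with ψ(p) = σ p (the structure variable X_p)
ψ : (Atom → Str) → PF → Str
ψ σ (atom p) = σ p
ψ σ top      = I
ψ σ (A & B)  = ψ σ A ∘ ψ σ B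
ψ σ (Fp A)   = ∗ • ∗ ψ σ A
ψ σ (Pp A)   = • ψ σ A

-- A one-premise rule Hyp / S is derivable iff
-- DK 𝒫 Hyp S is inhabited.

private
  variable
    X Y Z W : Str
    A B : Fml

data DK (𝒫 : List Axiom) (Hyp : Seq) : Seq → Set where
  hyp  : DK 𝒫 Hyp Hyp
  idp  : (p : Atom) → DK 𝒫 Hyp (⌜ var p ⌝ ⊢ ⌜ var p ⌝)
  ⊤R   : DK 𝒫 Hyp (I ⊢ ⌜ ⊤ᶠ ⌝)
  ⊥L   : DK 𝒫 Hyp (⌜ ⊥ᶠ ⌝ ⊢ I)
  ⊤L   : DK 𝒫 Hyp (I ⊢ Y) → DK 𝒫 Hyp (⌜ ⊤ᶠ ⌝ ⊢ Y)
  ⊥R   : DK 𝒫 Hyp (X ⊢ I) → DK 𝒫 Hyp (X ⊢ ⌜ ⊥ᶠ ⌝)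
  ¬L   : DK 𝒫 Hyp (∗ ⌜ A ⌝ ⊢ Y) → DK 𝒫 Hyp (⌜ ¬ᶠ A ⌝ ⊢ Y)
  ¬R   : DK 𝒫 Hyp (X ⊢ ∗ ⌜ A ⌝) → DK 𝒫 Hyp (X ⊢ ⌜ ¬ᶠ A ⌝)
  →R   : DK 𝒫 Hyp (X ∘ ⌜ A ⌝ ⊢ ⌜ B ⌝) → DK 𝒫 Hyp (X ⊢ ⌜ A →ᶠ B ⌝)
  →L   : DK 𝒫 Hyp (X ⊢ ⌜ A ⌝) → DK 𝒫 Hyp (⌜ B ⌝ ⊢ Y) → DK 𝒫 Hyp (⌜ A →ᶠ B ⌝ ⊢ ∗ X ∘ Y)
  ∨R   : DK 𝒫 Hyp (X ⊢ ⌜ A ⌝ ∘ ⌜ B ⌝) → DK 𝒫 Hyp (X ⊢ ⌜ A ∨ᶠ B ⌝)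
  ∨L   : DK 𝒫 Hyp (⌜ A ⌝ ⊢ Y) → DK 𝒫 Hyp (⌜ B ⌝ ⊢ Y) → DK 𝒫 Hyp (⌜ A ∨ᶠ B ⌝ ⊢ Y)
  ∧L   : DK 𝒫 Hyp (⌜ A ⌝ ∘ ⌜ B ⌝ ⊢ Y) → DK 𝒫 Hyp (⌜ A ∧ᶠ B ⌝ ⊢ Y)
  ∧R   : DK 𝒫 Hyp (X ⊢ ⌜ A ⌝) → DK 𝒫 Hyp (X ⊢ ⌜ B ⌝) → DK 𝒫 Hyp (X ⊢ ⌜ A ∧ᶠ B ⌝)
  GL   : DK 𝒫 Hyp (⌜ A ⌝ ⊢ Y) → DK 𝒫 Hyp (⌜ G A ⌝ ⊢ • Y)
  GR   : DK 𝒫 Hyp (• X ⊢ ⌜ A ⌝) → DK 𝒫 Hyp (X ⊢ ⌜ G A ⌝)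
  FL   : DK 𝒫 Hyp (⌜ A ⌝ ⊢ ∗ • ∗ Y) → DK 𝒫 Hyp (⌜ F A ⌝ ⊢ Y)
  FR   : DK 𝒫 Hyp (X ⊢ ⌜ A ⌝) → DK 𝒫 Hyp (∗ • ∗ X ⊢ ⌜ F A ⌝)
  HR   : DK 𝒫 Hyp (∗ • ∗ X ⊢ ⌜ A ⌝) → DK 𝒫 Hyp (X ⊢ ⌜ H A ⌝)
  HL   : DK 𝒫 Hyp (⌜ A ⌝ ⊢ Y) → DK 𝒫 Hyp (⌜ H A ⌝ ⊢ ∗ • ∗ Y)
  PL   : DK 𝒫 Hyp (⌜ A ⌝ ⊢ • Y) → DK 𝒫 Hyp (⌜ P A ⌝ ⊢ Y)
  PR   : DK 𝒫 Hyp (X ⊢ ⌜ A ⌝) → DK 𝒫 Hyp (• X ⊢ ⌜ P A ⌝)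
  d1→  : DK 𝒫 Hyp (X ∘ Y ⊢ Z) → DK 𝒫 Hyp (X ⊢ Z ∘ ∗ Y)
  d1←  : DK 𝒫 Hyp (X ⊢ Z ∘ ∗ Y) → DK 𝒫 Hyp (X ∘ Y ⊢ Z)
  d2→  : DK 𝒫 Hyp (X ∘ Y ⊢ Z) → DK 𝒫 Hyp (Y ⊢ ∗ X ∘ Z)
  d2←  : DK 𝒫 Hyp (Y ⊢ ∗ X ∘ Z) → DK 𝒫 Hyp (X ∘ Y ⊢ Z)
  d3→  : DK 𝒫 Hyp (X ⊢ Y ∘ Z) → DK 𝒫 Hyp (X ∘ ∗ Z ⊢ Y)
  d3←  : DK 𝒫 Hyp (X ∘ ∗ Z ⊢ Y) → DK 𝒫 Hyp (X ⊢ Y ∘ Z)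
  d4→  : DK 𝒫 Hyp (X ⊢ Y ∘ Z) → DK 𝒫 Hyp (∗ Y ∘ X ⊢ Z)
  d4←  : DK 𝒫 Hyp (∗ Y ∘ X ⊢ Z) → DK 𝒫 Hyp (X ⊢ Y ∘ Z)
  d5→  : DK 𝒫 Hyp (∗ X ⊢ Y) → DK 𝒫 Hyp (∗ Y ⊢ X)
  d5←  : DK 𝒫 Hyp (∗ Y ⊢ X) → DK 𝒫 Hyp (∗ X ⊢ Y)
  d6→  : DK 𝒫 Hyp (X ⊢ ∗ Y) → DK 𝒫 Hyp (Y ⊢ ∗ X)
  d6←  : DK 𝒫 Hyp (Y ⊢ ∗ X) → DK 𝒫 Hyp (X ⊢ ∗ Y)
  d7→  : DK 𝒫 Hyp (∗ ∗ X ⊢ Y) → DK 𝒫 Hyp (X ⊢ Y)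
  d7←  : DK 𝒫 Hyp (X ⊢ Y) → DK 𝒫 Hyp (∗ ∗ X ⊢ Y)
  d8→  : DK 𝒫 Hyp (X ⊢ ∗ ∗ Y) → DK 𝒫 Hyp (X ⊢ Y)
  d8←  : DK 𝒫 Hyp (X ⊢ Y) → DK 𝒫 Hyp (X ⊢ ∗ ∗ Y)
  d9→  : DK 𝒫 Hyp (X ⊢ • Y) → DK 𝒫 Hyp (• X ⊢ Y)
  d9←  : DK 𝒫 Hyp (• X ⊢ Y) → DK 𝒫 Hyp (X ⊢ • Y)
  IL→  : DK 𝒫 Hyp (X ⊢ Y) → DK 𝒫 Hyp (I ∘ X ⊢ Y)
  IL←  : DK 𝒫 Hyp (I ∘ X ⊢ Y) → DK 𝒫 Hyp (X ⊢ Y)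
  IR→  : DK 𝒫 Hyp (X ⊢ Y) → DK 𝒫 Hyp (X ⊢ I ∘ Y)
  IR←  : DK 𝒫 Hyp (X ⊢ I ∘ Y) → DK 𝒫 Hyp (X ⊢ Y)
  I∗L→ : DK 𝒫 Hyp (I ⊢ Y) → DK 𝒫 Hyp (∗ I ⊢ Y)
  I∗L← : DK 𝒫 Hyp (∗ I ⊢ Y) → DK 𝒫 Hyp (I ⊢ Y)
  I∗R→ : DK 𝒫 Hyp (X ⊢ I) → DK 𝒫 Hyp (X ⊢ ∗ I)
  I∗R← : DK 𝒫 Hyp (X ⊢ ∗ I) → DK 𝒫 Hyp (X ⊢ I)
  AL→  : DK 𝒫 Hyp (X ∘ (Y ∘ Z) ⊢ W) → DK 𝒫 Hyp ((X ∘ Y) ∘ Z ⊢ W)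
  AL←  : DK 𝒫 Hyp ((X ∘ Y) ∘ Z ⊢ W) → DK 𝒫 Hyp (X ∘ (Y ∘ Z) ⊢ W)
  AR→  : DK 𝒫 Hyp (X ⊢ Y ∘ (Z ∘ W)) → DK 𝒫 Hyp (X ⊢ (Y ∘ Z) ∘ W)
  AR←  : DK 𝒫 Hyp (X ⊢ (Y ∘ Z) ∘ W) → DK 𝒫 Hyp (X ⊢ Y ∘ (Z ∘ W))
  WL   : DK 𝒫 Hyp (X ⊢ Y) → DK 𝒫 Hyp (Z ∘ X ⊢ Y)
  WR   : DK 𝒫 Hyp (X ⊢ Y) → DK 𝒫 Hyp (X ⊢ Y ∘ Z)
  EL   : DK 𝒫 Hyp (X ∘ Y ⊢ Z) → DK 𝒫 Hyp (Y ∘ X ⊢ Z)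
  ER   : DK 𝒫 Hyp (X ⊢ Y ∘ Z) → DK 𝒫 Hyp (X ⊢ Z ∘ Y)
  CL   : DK 𝒫 Hyp (X ∘ X ⊢ Y) → DK 𝒫 Hyp (X ⊢ Y)
  CR   : DK 𝒫 Hyp (X ⊢ Y ∘ Y) → DK 𝒫 Hyp (X ⊢ Y)
  •IL  : DK 𝒫 Hyp (I ⊢ Y) → DK 𝒫 Hyp (• I ⊢ Y)
  •IR  : DK 𝒫 Hyp (X ⊢ I) → DK 𝒫 Hyp (X ⊢ • I)
  cut  : DK 𝒫 Hyp (X ⊢ ⌜ A ⌝) → DK 𝒫 Hyp (⌜ A ⌝ ⊢ Y) → DK 𝒫 Hyp (X ⊢ Y)
  ax   : {a : Axiom} → a ∈ 𝒫 → (σ : Atom → Str) →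
         (∀ {B′} → B′ ∈ toList (Axiom.disj a) → DK 𝒫 Hyp (ψ σ B′ ⊢ X)) →
         DK 𝒫 Hyp (ψ σ (Axiom.ante a) ⊢ X)

-- Labeled sequents  ℛ, Γ ⇒ Δ  (lists representing the set ℛ and the
-- multisets Γ, Δ)

Label : Set
Label = ℕ

record LFml : Set where
  constructor _∶_
  field
    lab : Label
    fml : Fml

record RelAt : Set where
  constructor R⟨_,_⟩
  field
    src : Label
    tgt : Label

record LSeq : Set where
  constructor ⟨_∣_⇒_⟩
  field
    rel : List RelAt
    ant : List LFml
    cons : List LFml

open LFml
open RelAt
open LSeq

LabelOf : Label → LSeq → Set
LabelOf w Λ = Any (λ r → src r ≡ w ⊎ tgt r ≡ w) (rel Λ)
            ⊎ Any (λ φ → lab φ ≡ w) (ant Λ)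
            ⊎ Any (λ φ → lab φ ≡ w) (cons Λ)

-- undirected steps and walks along the edges of ℛ (edges identified by
-- their position in the list)
data Step (ℛ : List RelAt) : Label → Label → Fin (length ℛ) → Set where
  fwd : (i : Fin (length ℛ)) → Step ℛ (src (lookup ℛ i)) (tgt (lookup ℛ i)) i
  bwd : (i : Fin (length ℛ)) → Step ℛ (tgt (lookup ℛ i)) (src (lookup ℛ i)) i

data Walk (ℛ : List RelAt) : Label → Label → List (Fin (length ℛ)) → Set where
  []  : ∀ {a} → Walk ℛ a a []
  _∷_ : ∀ {a b c i is} → Step ℛ a b i → Walk ℛ b c is → Walk ℛ a c (i ∷ is)

-- an (undirected, hence also any directed) cycle: a closed walk of
-- positive length using pairwise distinct edges
HasCycle : List RelAt → Set
HasCycle ℛ = Σ Label λ a → Σ (List (Fin (length ℛ))) λ is →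
             Walk ℛ a a is × is ≢ [] × Unique is

record IsPolytree (Λ : LSeq) : Set where
  field
    oneLabel   : rel Λ ≡ [] → Σ Label λ w →
                 All (λ φ → lab φ ≡ w) (ant Λ) × All (λ φ → lab φ ≡ w) (cons Λ)
    labelsInℛ  : rel Λ ≢ [] →
                 All (λ φ → Any (λ r → src r ≡ lab φ ⊎ tgt r ≡ lab φ) (rel Λ)) (ant Λ) ×
                 All (λ φ → Any (λ r → src r ≡ lab φ ⊎ tgt r ≡ lab φ) (rel Λ)) (cons Λ)
    connected  : ∀ a b → LabelOf a Λ → LabelOf b Λ →
                 Σ (List (Fin (length (rel Λ)))) λ is → Walk (rel Λ) a b is
    acyclic    : ¬ HasCycle (rel Λ)

filt : {A : Set} → (A → Bool) → List A → List A
filt p []       = []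
filt p (x ∷ xs) = if p x then x ∷ filt p xs else filt p xs

mem : ℕ → List ℕ → Bool
mem n []       = false
mem n (m ∷ ms) = (n ≡ᵇ m) or mem n ms

join : List Str → Str
join []           = I
join (x ∷ [])     = x
join (x ∷ y ∷ xs) = x ∘ join (y ∷ xs)

_↾_ : List LFml → Label → Str
Γ ↾ w = join (map (λ φ → ⌜ fml φ ⌝) (filt (λ φ → lab φ ≡ᵇ w) Γ))

expand : List RelAt → List Label → List Label
expand ℛ S = S ++ concatMap (λ r → (if mem (src r) S then tgt r ∷ [] else [])
                                 ++ (if mem (tgt r) S then src r ∷ [] else [])) ℛ

iterate : ℕ → (List Label → List Label) → List Label → List Label
iterate zero    f S = S
iterate (suc n) f S = iterate n f (f S)

between : Label → Label → RelAt → Bool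
between w u r = ((src r ≡ᵇ w) and (tgt r ≡ᵇ u)) or ((src r ≡ᵇ u) and (tgt r ≡ᵇ w))

-- Λ |^w_u : the part of Λ in the component of u after removing the edge
-- between w and u
restrict : LSeq → Label → Label → LSeq
restrict Λ w u = ⟨ filt (λ r → mem (src r) C and mem (tgt r) C) ℛ′
                 ∣ filt (λ φ → mem (lab φ) C) (ant Λ)
                 ⇒ filt (λ φ → mem (lab φ) C) (cons Λ) ⟩
  where
    ℛ′ = filt (λ r → not (between w u r)) (rel Λ)
    C  = iterate (suc (length (rel Λ))) (expand ℛ′) (u ∷ [])

succs : List RelAt → Label → List Label
succs ℛ w = map tgt (filt (λ r → src r ≡ᵇ w) ℛ)

preds : List RelAt → Label → List Label
preds ℛ w = map src (filt (λ r → tgt r ≡ᵇ w) ℛ)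

-- 𝔇₁, 𝔇₂ with fuel (each recursive call removes at least one relational
-- atom, so fuel 1 + |ℛ| is always enough)
D1′ D2′ : ℕ → Label → LSeq → Str
D1′ zero    w Λ = I
D1′ (suc n) w Λ with rel Λ
... | [] = (ant Λ ↾ w) ∘ ∗ (cons Λ ↾ w)
... | ℛ@(_ ∷ _) = join ((ant Λ ↾ w) ∷ ∗ (cons Λ ↾ w) ∷
                    (map (λ u → ∗ • ∗ D1′ n u (restrict Λ w u)) (succs ℛ w)
                     ++ map (λ v → • D1′ n v (restrict Λ w v)) (preds ℛ w)))
D2′ zero    w Λ = I
D2′ (suc n) w Λ with rel Λ
... | [] = ∗ (ant Λ ↾ w) ∘ (cons Λ ↾ w)
... | ℛ@(_ ∷ _) = join (∗ (ant Λ ↾ w) ∷ (cons Λ ↾ w) ∷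
                    (map (λ u → • D2′ n u (restrict Λ w u)) (succs ℛ w)
                     ++ map (λ v → ∗ • ∗ D2′ n v (restrict Λ w v)) (preds ℛ w)))

𝔇₁ 𝔇₂ : Label → LSeq → Str
𝔇₁ w Λ = D1′ (suc (length (rel Λ))) w Λ
𝔇₂ w Λ = D2′ (suc (length (rel Λ))) w Λ

BothWays : List Axiom → Seq → Seq → Set
BothWays 𝒫 S₁ S₂ = DK 𝒫 S₁ S₂ × DK 𝒫 S₂ S₁

-- Call structures a and b dual when a ⊢ X is interderivable with ∗ b ⊢ X and
-- ∗ a ⊢ X with b ⊢ X, for every X.  Using only display rules and exchange,
-- duality is symmetric, relates I to I and a to ∗ a, is preserved by ∘, and
-- turns a dual pair a, b into the dual pair ∗ • ∗ a, • b.  𝔇₁ and 𝔇₂ are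
-- assembled from the same pieces by exactly these constructions (with the
-- roles of ∗ • ∗ and • swapped), so they are dual by induction on the fuel.
-- The four rules are the two clauses of duality and their transforms to the
-- right of the turnstile.
module Submission where

open import Defs
open import Data.List using (List; []; _∷_; length; map)
open import Data.List.Relation.Binary.Pointwise using (Pointwise; []; _∷_; ++⁺; map⁺; refl)
open import Data.Nat using (zero; suc)
open import Data.Product using (_×_; _,_)
open import Function.Bundles using (_⇔_; mk⇔; Equivalence)
open import Function.Properties.Equivalence using (⇔-setoid)
import Function.Properties.Equivalence as ⇔
open import Level using (0ℓ)
open import Relation.Binary.Reasoning.Setoid (⇔-setoid 0ℓ)

module _ {𝒫 : List Axiom} {Hyp : Seq} where

  private
    Der : Seq → Set
    Der = DK 𝒫 Hyp

    variable
      X Y Z : Str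
      a b c e : Str

  display₁ : Der (X ∘ Y ⊢ Z) ⇔ Der (X ⊢ Z ∘ ∗ Y)
  display₁ = mk⇔ d1→ d1←

  display₃ : Der (X ⊢ Y ∘ Z) ⇔ Der (X ∘ ∗ Z ⊢ Y)
  display₃ = mk⇔ d3→ d3←

  display₄ : Der (X ⊢ Y ∘ Z) ⇔ Der (∗ Y ∘ X ⊢ Z)
  display₄ = mk⇔ d4→ d4←

  display₅ : Der (∗ X ⊢ Y) ⇔ Der (∗ Y ⊢ X)
  display₅ = mk⇔ d5→ d5←

  display₆ : Der (X ⊢ ∗ Y) ⇔ Der (Y ⊢ ∗ X)
  display₆ = mk⇔ d6→ d6←

  display₇ : Der (∗ ∗ X ⊢ Y) ⇔ Der (X ⊢ Y)
  display₇ = mk⇔ d7→ d7←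

  display₈ : Der (X ⊢ ∗ ∗ Y) ⇔ Der (X ⊢ Y)
  display₈ = mk⇔ d8→ d8←

  display₉ : Der (X ⊢ • Y) ⇔ Der (• X ⊢ Y)
  display₉ = mk⇔ d9→ d9←

  exchangeˡ : Der (X ∘ Y ⊢ Z) ⇔ Der (Y ∘ X ⊢ Z)
  exchangeˡ = mk⇔ EL EL

  exchangeʳ : Der (X ⊢ Y ∘ Z) ⇔ Der (X ⊢ Z ∘ Y)
  exchangeʳ = mk⇔ ER ER

  infix 4 _≈ˡ_

  _≈ˡ_ : Str → Str → Set
  a ≈ˡ b = ∀ {X} → Der (a ⊢ X) ⇔ Der (b ⊢ X)

  ≈ˡ-refl : a ≈ˡ a
  ≈ˡ-refl = ⇔.refl

  ≈ˡ-sym : a ≈ˡ b → b ≈ˡ a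
  ≈ˡ-sym a≈b = ⇔.sym a≈b

  ≈ˡ-trans : a ≈ˡ b → b ≈ˡ c → a ≈ˡ c
  ≈ˡ-trans a≈b b≈c = ⇔.trans a≈b b≈c

  ∘-comm : a ∘ b ≈ˡ b ∘ a
  ∘-comm = exchangeˡ

  ∘-congˡ : a ≈ˡ b → a ∘ c ≈ˡ b ∘ c
  ∘-congˡ {a} {b} {c} a≈b {X} = begin
    Der (a ∘ c ⊢ X)      ≈⟨ display₁ ⟩
    Der (a ⊢ X ∘ ∗ c)    ≈⟨ a≈b ⟩
    Der (b ⊢ X ∘ ∗ c)    ≈⟨ display₁ ⟨
    Der (b ∘ c ⊢ X)      ∎

  ∘-cong : a ≈ˡ b → c ≈ˡ e → a ∘ c ≈ˡ b ∘ e
  ∘-cong a≈b c≈e =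
    ≈ˡ-trans (∘-congˡ a≈b) (≈ˡ-trans ∘-comm (≈ˡ-trans (∘-congˡ c≈e) ∘-comm))

  ∗-distrib-∘ : ∗ a ∘ ∗ b ≈ˡ ∗ (a ∘ b)
  ∗-distrib-∘ {a} {b} {X} = begin
    Der (∗ a ∘ ∗ b ⊢ X)  ≈⟨ display₃ ⟨
    Der (∗ a ⊢ X ∘ b)    ≈⟨ display₄ ⟩
    Der (∗ X ∘ ∗ a ⊢ b)  ≈⟨ display₃ ⟨
    Der (∗ X ⊢ b ∘ a)    ≈⟨ exchangeʳ ⟩
    Der (∗ X ⊢ a ∘ b)    ≈⟨ display₅ ⟩
    Der (∗ (a ∘ b) ⊢ X)  ∎

  record Dual (a b : Str) : Set where
    field
      left  : a ≈ˡ ∗ b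
      left∗ : ∗ a ≈ˡ b

  open Dual

  Dual-sym : Dual a b → Dual b a
  Dual-sym a∼b = record { left = ≈ˡ-sym (left∗ a∼b) ; left∗ = ≈ˡ-sym (left a∼b) }

  Dual-I : Dual I I
  Dual-I = record { left = mk⇔ I∗L→ I∗L← ; left∗ = mk⇔ I∗L← I∗L→ }

  Dual-∗ : Dual a (∗ a)
  Dual-∗ = record { left = ⇔.sym display₇ ; left∗ = ≈ˡ-refl }

  Dual-∘ : Dual a b → Dual c e → Dual (a ∘ c) (b ∘ e)
  Dual-∘ a∼b c∼e = record
    { left  = ≈ˡ-trans (∘-cong (left a∼b) (left c∼e)) ∗-distrib-∘
    ; left∗ = ≈ˡ-trans (≈ˡ-sym ∗-distrib-∘) (∘-cong (left∗ a∼b) (left∗ c∼e))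
    }

  Dual-⊢∗ : Dual a b → Der (X ⊢ ∗ a) ⇔ Der (X ⊢ b)
  Dual-⊢∗ {a} {b} {X} a∼b = begin
    Der (X ⊢ ∗ a)      ≈⟨ display₆ ⟩
    Der (a ⊢ ∗ X)      ≈⟨ left a∼b ⟩
    Der (∗ b ⊢ ∗ X)    ≈⟨ display₆ ⟩
    Der (X ⊢ ∗ ∗ b)    ≈⟨ display₈ ⟩
    Der (X ⊢ b)        ∎

  Dual-⊢ : Dual a b → Der (X ⊢ a) ⇔ Der (X ⊢ ∗ b)
  Dual-⊢ a∼b = ⇔.sym (Dual-⊢∗ (Dual-sym a∼b))

  Dual-F : Dual a b → Dual (∗ • ∗ a) (• b)
  Dual-F {a} {b} a∼b = record { left = left′ ; left∗ = left∗′ }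
    where
      left′ : ∗ • ∗ a ≈ˡ ∗ • b
      left′ {X} = begin
        Der (∗ • ∗ a ⊢ X)    ≈⟨ display₅ ⟩
        Der (∗ X ⊢ • ∗ a)    ≈⟨ display₉ ⟩
        Der (• ∗ X ⊢ ∗ a)    ≈⟨ Dual-⊢∗ a∼b ⟩
        Der (• ∗ X ⊢ b)      ≈⟨ display₉ ⟨
        Der (∗ X ⊢ • b)      ≈⟨ display₅ ⟩
        Der (∗ • b ⊢ X)      ∎

      left∗′ : ∗ ∗ • ∗ a ≈ˡ • b
      left∗′ {X} = begin
        Der (∗ ∗ • ∗ a ⊢ X)  ≈⟨ display₇ ⟩
        Der (• ∗ a ⊢ X)      ≈⟨ display₉ ⟨
        Der (∗ a ⊢ • X)      ≈⟨ left∗ a∼b ⟩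
        Der (b ⊢ • X)        ≈⟨ display₉ ⟩
        Der (• b ⊢ X)        ∎

  Dual-join : ∀ {xs ys} → Pointwise Dual xs ys → Dual (join xs) (join ys)
  Dual-join []                    = Dual-I
  Dual-join (x∼y ∷ [])            = x∼y
  Dual-join (x∼y ∷ xs∼ys@(_ ∷ _)) = Dual-∘ x∼y (Dual-join xs∼ys)

  Dual-map : {A : Set} (f g : A → Str) → (∀ x → Dual (f x) (g x)) →
             ∀ xs → Pointwise Dual (map f xs) (map g xs)
  Dual-map f g f∼g xs = map⁺ f g (refl (λ {x} → f∼g x) {xs})

  D1′-Dual-D2′ : ∀ n w Λ → Dual (D1′ n w Λ) (D2′ n w Λ)
  D1′-Dual-D2′ zero    w Λ                 = Dual-I
  D1′-Dual-D2′ (suc n) w ⟨ [] ∣ Γ ⇒ Δ ⟩     = Dual-∘ Dual-∗ (Dual-sym Dual-∗)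
  D1′-Dual-D2′ (suc n) w Λ@(⟨ ℛ@(_ ∷ _) ∣ Γ ⇒ Δ ⟩) =
    Dual-join (Dual-∗ ∷ Dual-sym Dual-∗ ∷
               ++⁺ (Dual-map _ _ (λ u → Dual-F (IH u)) (succs ℛ w))
                   (Dual-map _ _ (λ v → Dual-sym (Dual-F (Dual-sym (IH v)))) (preds ℛ w)))
    where
      IH : ∀ u → Dual (D1′ n u (restrict Λ w u)) (D2′ n u (restrict Λ w u))
      IH u = D1′-Dual-D2′ n u (restrict Λ w u)

  𝔇₁-Dual-𝔇₂ : ∀ w Λ → Dual (𝔇₁ w Λ) (𝔇₂ w Λ)
  𝔇₁-Dual-𝔇₂ w Λ = D1′-Dual-D2′ (suc (length (LSeq.rel Λ))) w Λ

bothWays : ∀ {𝒫 S₁ S₂} → (∀ {Hyp} → DK 𝒫 Hyp S₁ ⇔ DK 𝒫 Hyp S₂) → BothWays 𝒫 S₁ S₂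
bothWays S₁⇔S₂ = Equivalence.to S₁⇔S₂ hyp , Equivalence.from S₁⇔S₂ hyp

lemma6 : (𝒫 : List Axiom) (Λ : LSeq) (w : Label) → IsPolytree Λ → LabelOf w Λ →
         (X : Str) →
         BothWays 𝒫 (𝔇₁ w Λ ⊢ X) (∗ 𝔇₂ w Λ ⊢ X)
         × BothWays 𝒫 (∗ 𝔇₁ w Λ ⊢ X) (𝔇₂ w Λ ⊢ X)
         × BothWays 𝒫 (X ⊢ 𝔇₂ w Λ) (X ⊢ ∗ 𝔇₁ w Λ)
         × BothWays 𝒫 (X ⊢ ∗ 𝔇₂ w Λ) (X ⊢ 𝔇₁ w Λ)
lemma6 𝒫 Λ w _ _ X =
    bothWays (Dual.left duality)
  , bothWays (Dual.left∗ duality)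
  , bothWays (Dual-⊢ (Dual-sym duality))
  , bothWays (Dual-⊢∗ (Dual-sym duality))
  where
    duality : ∀ {Hyp} → Dual {𝒫} {Hyp} (𝔇₁ w Λ) (𝔇₂ w Λ)
    duality = 𝔇₁-Dual-𝔇₂ w Λ
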